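{- Let $H$ be a Heyting algebra (with bottom $0$, top $1$, meet $\land$, join $\lor$, Heyting implication $\to$). Let $\mathrm{Chu}(H,0)=\{(a_+,a_-)\in H\times H : a_+\land a_-=0\}$, equipped with the linear-logic operations \[ a\oplus b=(a_+\land b_+,\ a_-\lor b_-),\quad a\mathbin{\&} b=(a_+\lor b_+,\ a_-\land b_-),\quad a^\bot=(a_-,a_+), \] \[ a\otimes b=(a_+\land b_+,\ (a_+\to b_-)\land(b_+\to a_-)),\quad a\mathbin{\wp} b=((a_-\to b_+)\land(b_-\to a_+),\ a_-\land b_-), \] \[ a\multimap b=((a_+\to b_+)\land(b_-\to a_-),\ a_+\land b_-),\quad !a=(a_+,\ a_+\to 0),\quad ?a=(a_-\to 0,\ a_-). \] On $H\times H$ consider the bilattice operations \[ (a_+,a_-)\mathbin{\dot\wedge}(b_+,b_-)=(a_+\land b_+,\ a_-\lor b_-),\qquad (a_+,a_-)\mathbin{\dot\vee}(b_+,b_-)=(a_+\lor b_+,\ a_-\land b_-), \] \[ \neg(a_+,a_-)=(a_-,a_+),\qquad \mathsf f=(0,1),\qquad (a_+,a_-)\supset(b_+,b_-)=(a_+\to b_+,\ a_+\land b_-), \] the strong implication $x\Rightarrow y=(x\supset y)\mathbin{\dot\wedge}(\neg y\supset\neg x)$, and the fusion $x*y=\neg(y\Rightarrow\neg x)$. Then for all $a,b\in\mathrm{Chu}(H,0)$: \[ a\oplus b=a\mathbin{\dot\wedge} b,\quad a\mathbin{\&} b=a\mathbin{\dot\vee} b,\quad a^\bot=\neg a,\quad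 a\otimes b=\neg(a\Rightarrow\neg b)=a*b, \] \[ a\mathbin{\wp} b=\neg a\Rightarrow b,\quad a\multimap b=a\Rightarrow b,\quad !a=\neg(a\supset\mathsf f),\quad ?a=(\neg a)\supset\mathsf f. \]
   Context: All operations on the right-hand sides are computed in $H\times H$ (the twist-structure of $H$ with itself) using the displayed formulas; subscripts $+$ and $-$ denote the first and second components of a pair. -}

module Defs where

open import Level using (_⊔_)
open import Data.Product using (_×_; _,_; proj₁; proj₂)
open import Relation.Binary.Lattice.Bundles using (HeytingAlgebra)

module Twist {c ℓ₁ ℓ₂} (H : HeytingAlgebra c ℓ₁ ℓ₂) where
  open HeytingAlgebra H

  Pair : Set c
  Pair = Carrier × Carrier

  _₊ : Pair → Carrier
  _₊ = proj₁

  _₋ : Pair → Carrier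
  _₋ = proj₂

  _≈ₚ_ : Pair → Pair → Set ℓ₁
  a ≈ₚ b = ((a ₊) ≈ (b ₊)) × ((a ₋) ≈ (b ₋))

  InChu : Pair → Set ℓ₁
  InChu a = ((a ₊) ∧ (a ₋)) ≈ ⊥

  _⊕_ : Pair → Pair → Pair
  a ⊕ b = ((a ₊) ∧ (b ₊) , (a ₋) ∨ (b ₋))

  _&_ : Pair → Pair → Pair
  a & b = ((a ₊) ∨ (b ₊) , (a ₋) ∧ (b ₋))

  _ᗮ : Pair → Pair
  a ᗮ = (a ₋ , a ₊)

  _⊗_ : Pair → Pair → Pair
  a ⊗ b = ((a ₊) ∧ (b ₊) , ((a ₊) ⇨ (b ₋)) ∧ ((b ₊) ⇨ (a ₋)))

  _⅋_ : Pair → Pair → Pair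
  a ⅋ b = (((a ₋) ⇨ (b ₊)) ∧ ((b ₋) ⇨ (a ₊)) , (a ₋) ∧ (b ₋))

  _⊸_ : Pair → Pair → Pair
  a ⊸ b = (((a ₊) ⇨ (b ₊)) ∧ ((b ₋) ⇨ (a ₋)) , (a ₊) ∧ (b ₋))

  !_ : Pair → Pair
  ! a = (a ₊ , (a ₊) ⇨ ⊥)

  ¿_ : Pair → Pair
  ¿ a = ((a ₋) ⇨ ⊥ , a ₋)

  _∧̇_ : Pair → Pair → Pair
  a ∧̇ b = ((a ₊) ∧ (b ₊) , (a ₋) ∨ (b ₋))

  _∨̇_ : Pair → Pair → Pair
  a ∨̇ b = ((a ₊) ∨ (b ₊) , (a ₋) ∧ (b ₋))

  ¬̇_ : Pair → Pair
  ¬̇ a = (a ₋ , a ₊)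

  𝖿 : Pair
  𝖿 = (⊥ , ⊤)

  _⊃_ : Pair → Pair → Pair
  a ⊃ b = ((a ₊) ⇨ (b ₊) , (a ₊) ∧ (b ₋))

  _⇛_ : Pair → Pair → Pair
  x ⇛ y = (x ⊃ y) ∧̇ ((¬̇ y) ⊃ (¬̇ x))

  _✱_ : Pair → Pair → Pair
  x ✱ y = ¬̇ (y ⇛ (¬̇ x))

  Lemma2Concl : Pair → Pair → Set ℓ₁
  Lemma2Concl a b =
      ((a ⊕ b) ≈ₚ (a ∧̇ b))
    × ((a & b) ≈ₚ (a ∨̇ b))
    × ((a ᗮ) ≈ₚ (¬̇ a))
    × ((a ⊗ b) ≈ₚ (¬̇ (a ⇛ (¬̇ b))))
    × ((¬̇ (a ⇛ (¬̇ b))) ≈ₚ (a ✱ b))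
    × ((a ⅋ b) ≈ₚ ((¬̇ a) ⇛ b))
    × ((a ⊸ b) ≈ₚ (a ⇛ b))
    × ((! a) ≈ₚ (¬̇ (a ⊃ 𝖿)))
    × ((¿ a) ≈ₚ ((¬̇ a) ⊃ 𝖿))

module Submission where

open import Defs
open import Data.Product using (_,_)
open import Relation.Binary.Lattice.Bundles using (Lattice; HeytingAlgebra)
import Relation.Binary.Lattice.Properties.JoinSemilattice as JoinSemilatticeProperties
import Relation.Binary.Lattice.Properties.MeetSemilattice as MeetSemilatticeProperties
import Relation.Binary.Lattice.Properties.BoundedMeetSemilattice as BoundedMeetSemilatticeProperties

-- Each identity is a componentwise computation in H: the two halves of a strong
-- implication meet and join a term with its commuted copy, and ⊃ against 𝖿
-- contributes x ⇨ ⊥ and x ∧ ⊤.  None of this uses the Chu condition.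

module _ {c ℓ₁ ℓ₂} (L : Lattice c ℓ₁ ℓ₂) where
  open Lattice L
  open JoinSemilatticeProperties joinSemilattice using (∨-idempotent; ∨-cong)
  open MeetSemilatticeProperties meetSemilattice using (∧-comm)

  x∧y≈x∧y∨y∧x : ∀ x y → x ∧ y ≈ (x ∧ y) ∨ (y ∧ x)
  x∧y≈x∧y∨y∧x x y = Eq.sym (Eq.trans (∨-cong Eq.refl (∧-comm y x)) (∨-idempotent (x ∧ y)))

module TwistProperties {c ℓ₁ ℓ₂} (H : HeytingAlgebra c ℓ₁ ℓ₂) where
  open HeytingAlgebra H
  open Twist H
  open JoinSemilatticeProperties joinSemilattice using (∨-comm)
  open MeetSemilatticeProperties meetSemilattice using (∧-comm)
  open BoundedMeetSemilatticeProperties boundedMeetSemilattice using (identityʳ)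

  ⊕≈∧̇ : ∀ a b → (a ⊕ b) ≈ₚ (a ∧̇ b)
  ⊕≈∧̇ _ _ = Eq.refl , Eq.refl

  &≈∨̇ : ∀ a b → (a & b) ≈ₚ (a ∨̇ b)
  &≈∨̇ _ _ = Eq.refl , Eq.refl

  ᗮ≈¬̇ : ∀ a → (a ᗮ) ≈ₚ (¬̇ a)
  ᗮ≈¬̇ _ = Eq.refl , Eq.refl

  ⊗≈¬̇[⇛¬̇] : ∀ a b → (a ⊗ b) ≈ₚ (¬̇ (a ⇛ (¬̇ b)))
  ⊗≈¬̇[⇛¬̇] (a₊ , _) (b₊ , _) = x∧y≈x∧y∨y∧x lattice a₊ b₊ , Eq.refl

  ¬̇[⇛¬̇]≈✱ : ∀ a b → (¬̇ (a ⇛ (¬̇ b))) ≈ₚ (a ✱ b)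
  ¬̇[⇛¬̇]≈✱ (a₊ , a₋) (b₊ , b₋) = ∨-comm (a₊ ∧ b₊) (b₊ ∧ a₊) , ∧-comm (a₊ ⇨ b₋) (b₊ ⇨ a₋)

  ⅋≈¬̇⇛ : ∀ a b → (a ⅋ b) ≈ₚ ((¬̇ a) ⇛ b)
  ⅋≈¬̇⇛ (_ , a₋) (_ , b₋) = Eq.refl , x∧y≈x∧y∨y∧x lattice a₋ b₋

  ⊸≈⇛ : ∀ a b → (a ⊸ b) ≈ₚ (a ⇛ b)
  ⊸≈⇛ (a₊ , _) (_ , b₋) = Eq.refl , x∧y≈x∧y∨y∧x lattice a₊ b₋

  !≈¬̇[⊃𝖿] : ∀ a → (! a) ≈ₚ (¬̇ (a ⊃ 𝖿))
  !≈¬̇[⊃𝖿] (a₊ , _) = Eq.sym (identityʳ a₊) , Eq.refl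

  ¿≈¬̇⊃𝖿 : ∀ a → (¿ a) ≈ₚ ((¬̇ a) ⊃ 𝖿)
  ¿≈¬̇⊃𝖿 (_ , a₋) = Eq.refl , Eq.sym (identityʳ a₋)

lemma2 : ∀ {c ℓ₁ ℓ₂} (H : HeytingAlgebra c ℓ₁ ℓ₂) (a b : Twist.Pair H) →
    Twist.InChu H a → Twist.InChu H b → Twist.Lemma2Concl H a b
lemma2 H a b _ _ =
    ⊕≈∧̇ a b
  , &≈∨̇ a b
  , ᗮ≈¬̇ a
  , ⊗≈¬̇[⇛¬̇] a b
  , ¬̇[⇛¬̇]≈✱ a b
  , ⅋≈¬̇⇛ a b
  , ⊸≈⇛ a b
  , !≈¬̇[⊃𝖿] a
  , ¿≈¬̇⊃𝖿 a
  where open TwistProperties H
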